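{- Let $t$ be a positive integer and let $G$ be one of $P_t$ (the path on $t$ vertices), $K_{t,t}$, or $K_{t,t+1}$ (complete bipartite graphs). Let $p:=|V(G)|$ and let $k$ be an integer with $1\le k\le p-1$. Then \[\beta(F_k(G))=\max\Big\{r,\ \binom{p}{k}-r\Big\},\qquad r:=\sum_{i=1}^{\lceil k/2\rceil}\binom{\lceil p/2\rceil}{2i-1}\binom{\lfloor p/2\rfloor}{k-2i+1}.\]
   Context: For a simple finite graph $G$ of order $N$ and an integer $1\le k\le N-1$, the $k$-token graph $F_k(G)$ is the graph whose vertices are all $k$-element subsets of $V(G)$, two such subsets being adjacent iff their symmetric difference is an edge of $G$. $\beta$ denotes the independence number. -}

module Defs where

open import Data.Nat using (ℕ; zero; suc; _+_; _*_; _∸_; _≤_; _<_; ⌊_/2⌋; ⌈_/2⌉; _⊔_)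
open import Data.Nat.Combinatorics using (_C_)
open import Data.Fin using (Fin; toℕ)
open import Data.Fin.Subset using (Subset; _∪_; _─_; ⁅_⁆; ∣_∣)
open import Data.List using (List; length)
open import Data.List.Membership.Propositional using (_∈_)
open import Data.List.Relation.Unary.Unique.Propositional using (Unique)
open import Data.List.Relation.Unary.All using (All)
open import Data.Product using (Σ; ∃₂; _×_)
open import Data.Sum using (_⊎_)
open import Relation.Binary.PropositionalEquality using (_≡_)
open import Relation.Nullary using (¬_)

Graph : ℕ → Set₁
Graph n = Fin n → Fin n → Set

pathGraph : (t : ℕ) → Graph t
pathGraph t i j = (toℕ j ≡ suc (toℕ i)) ⊎ (toℕ i ≡ suc (toℕ j))

completeBipartite : (a b : ℕ) → Graph (a + b)
completeBipartite a b i j = (toℕ i < a × a ≤ toℕ j) ⊎ (toℕ j < a × a ≤ toℕ i)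

data Family (t : ℕ) : (p : ℕ) → Graph p → Set₁ where
  isPath  : Family t t (pathGraph t)
  isKtt   : Family t (t + t) (completeBipartite t t)
  isKtt+1 : Family t (t + suc t) (completeBipartite t (suc t))

_⊖_ : ∀ {n} → Subset n → Subset n → Subset n
A ⊖ B = (A ─ B) ∪ (B ─ A)

-- Adjacency in the token graph F_k(G): symmetric difference is an edge {u,v} of G.
-- (The vertex set of F_k(G) is the set of subsets of size k; see IndependentTokenSet.)
TokenAdj : ∀ {n} → Graph n → Subset n → Subset n → Set
TokenAdj G A B = ∃₂ λ u v → G u v × (A ⊖ B ≡ ⁅ u ⁆ ∪ ⁅ v ⁆)

record IndependentTokenSet {n} (G : Graph n) (k : ℕ) (L : List (Subset n)) : Set where
  field
    unique   : Unique L
    sizes    : All (λ S → ∣ S ∣ ≡ k) L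
    nonAdj   : ∀ {A B} → A ∈ L → B ∈ L → ¬ TokenAdj G A B

IndependenceNumberTok : ∀ {n} → Graph n → ℕ → ℕ → Set
IndependenceNumberTok G k m =
  (Σ (List (Subset _)) λ L → IndependentTokenSet G k L × length L ≡ m)
  × (∀ L → IndependentTokenSet G k L → length L ≤ m)

sum1 : ℕ → (ℕ → ℕ) → ℕ
sum1 zero    f = 0
sum1 (suc m) f = sum1 m f + f (suc m)

rVal : ℕ → ℕ → ℕ
rVal p k = sum1 ⌈ k /2⌉ (λ i → (⌈ p /2⌉ C (2 * i ∸ 1)) * (⌊ p /2⌋ C ((k + 1) ∸ 2 * i)))

-- Colour G properly with ⌈p/2⌉ red and ⌊p/2⌋ blue vertices (alternately along the path, by
-- sides in K_{t,t} and K_{t,t+1}). Moving a token along an edge changes the parity of the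
-- number of red tokens, so each parity class of k-sets is independent in F_k(G), and a
-- Vandermonde-type count shows the odd class has exactly r elements. Conversely, G contains
-- a matching of ⌊p/2⌋ red-blue pairs covering all but at most one (red) vertex. A k-set that
-- meets every pair in 0 or 2 vertices has the parity of ⌈k/2⌉, so every k-set of the other
-- parity meets some pair in one vertex, and moving that token across the first such pair is
-- an involution joining it to an adjacent k-set of parity ⌈k/2⌉. An independent set contains
-- at most one end of each such edge, so it injects into the class of parity ⌈k/2⌉, which is
-- therefore the larger class and a maximum independent set.

module Submission where

open import Defs
open import Data.Nat using (ℕ; zero; suc; _+_; _*_; _∸_; _≤_; _<_; ⌊_/2⌋; ⌈_/2⌉; _⊔_; z≤n; s≤s)
open import Data.Nat.Properties
  using ( +-comm; +-assoc; +-suc; +-identityʳ; *-suc; *-distribˡ-+; *-distribʳ-+; +-∸-assoc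
        ; n∸n≡0; m+n∸m≡n; suc-injective; ≤-trans; ≤-reflexive; m≤m+n; m≥n⇒m⊔n≡m; m≤n⇒m⊔n≡n
        ; +-commutativeSemigroup; module ≤-Reasoning )
open import Data.Nat.Combinatorics using (_C_; nCk+nC[k+1]≡[n+1]C[k+1])
open import Data.Bool using (Bool; true; false; not; _∧_; _xor_; if_then_else_)
open import Data.Bool.Properties
  using ( _≟_; not-involutive; not-injective; not-¬; ¬-not; if-float; if-eta; ∧-zeroʳ; ∧-identityʳ
        ; ∧-distribˡ-xor; not-distribˡ-xor; not-distribʳ-xor; xor-identityʳ; xor-inverseˡ; xor-comm
        ; xor-assoc; xor-∧-commutativeRing )
open import Data.Vec using (Vec; []; _∷_; lookup; replicate; _++_; take; drop)
open import Data.Vec.Properties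
  using (∷-injectiveʳ; take++drop≡id; ++-injectiveˡ; ++-injectiveʳ; lookup-replicate)
open import Data.Fin using (Fin; zero; suc; toℕ; _↑ˡ_; _↑ʳ_)
open import Data.Fin.Properties using (toℕ-↑ˡ; toℕ-↑ʳ; toℕ<n)
open import Data.Fin.Subset using (Subset; ∣_∣; _∪_; ⁅_⁆; ⊥)
open import Data.Fin.Subset.Properties using (∪-identityˡ; ∪-identityʳ)
open import Data.List using (List; []; _∷_; map; length) renaming (_++_ to _++ₗ_)
open import Data.List.Properties using (length-map; length-++; length-removeAt′)
open import Data.List.Membership.Propositional using (_∈_)
open import Data.List.Membership.Propositional.Properties
  using (∈-map⁻; ∈-map⁺; ∈-++⁻; ∈-++⁺ˡ; ∈-++⁺ʳ)
open import Data.List.Relation.Unary.Any using (here; there; _─_)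
open import Data.List.Relation.Unary.Unique.Propositional using (Unique)
open import Data.List.Relation.Unary.AllPairs using ([]; _∷_)
open import Data.List.Relation.Unary.All using ([])
import Data.List.Relation.Unary.All as All
import Data.List.Relation.Unary.Unique.Propositional.Properties as Unique
open import Data.Product using (_×_; _,_; proj₁; proj₂; ∃; uncurry)
import Data.Product as Product
open import Data.Empty using (⊥-elim)
open import Data.Sum using (inj₁; inj₂)
import Data.Sum as Sum
open import Function using (_∘_)
open import Relation.Nullary using (¬_; yes; no)
open import Relation.Binary.PropositionalEquality
open import Algebra.Bundles using (CommutativeRing)
open import Algebra.Properties.CommutativeSemigroup +-commutativeSemigroup
  using () renaming (interchange to +-interchange)
open import Algebra.Properties.CommutativeSemigroup
  (CommutativeRing.+-commutativeSemigroup xor-∧-commutativeRing)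
  using () renaming (interchange to xor-interchange)

-- Parity-restricted Vandermonde sums

sumBelow : ℕ → (ℕ → ℕ) → ℕ
sumBelow zero    f = 0
sumBelow (suc n) f = f 0 + sumBelow n (f ∘ suc)

sumBelow-cong : ∀ n {f g : ℕ → ℕ} → (∀ j → j < n → f j ≡ g j) → sumBelow n f ≡ sumBelow n g
sumBelow-cong zero    f≡g = refl
sumBelow-cong (suc n) f≡g =
  cong₂ _+_ (f≡g 0 (s≤s z≤n)) (sumBelow-cong n (λ j j<n → f≡g (suc j) (s≤s j<n)))

sumBelow-+ : ∀ n (f g : ℕ → ℕ) → sumBelow n (λ j → f j + g j) ≡ sumBelow n f + sumBelow n g
sumBelow-+ zero    f g = refl
sumBelow-+ (suc n) f g =
  trans (cong (f 0 + g 0 +_) (sumBelow-+ n (f ∘ suc) (g ∘ suc))) (+-interchange (f 0) (g 0) _ _)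

sumBelow-suc : ∀ n (f : ℕ → ℕ) → sumBelow (suc n) f ≡ sumBelow n f + f n
sumBelow-suc zero    f = +-comm (f 0) 0
sumBelow-suc (suc n) f = trans (cong (f 0 +_) (sumBelow-suc n (f ∘ suc))) (sym (+-assoc (f 0) _ _))

sumBelow-zero : ∀ n (f : ℕ → ℕ) → (∀ j → f j ≡ 0) → sumBelow n f ≡ 0
sumBelow-zero zero    f f≡0 = refl
sumBelow-zero (suc n) f f≡0 = cong₂ _+_ (f≡0 0) (sumBelow-zero n (f ∘ suc) (f≡0 ∘ suc))

sum1-cong : ∀ m {f g : ℕ → ℕ} → (∀ i → f (suc i) ≡ g (suc i)) → sum1 m f ≡ sum1 m g
sum1-cong zero    f≡g = refl
sum1-cong (suc m) f≡g = cong₂ _+_ (sum1-cong m f≡g) (f≡g m)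

odd : ℕ → Bool
odd zero    = false
odd (suc n) = not (odd n)

twice-⌈/2⌉ : ∀ k → 2 * ⌈ k /2⌉ ≡ (if odd k then suc k else k)
twice-⌈/2⌉ zero          = refl
twice-⌈/2⌉ (suc zero)    = refl
twice-⌈/2⌉ (suc (suc k)) = begin
  2 * suc ⌈ k /2⌉
    ≡⟨ *-suc 2 ⌈ k /2⌉ ⟩
  2 + 2 * ⌈ k /2⌉
    ≡⟨ cong (2 +_) (twice-⌈/2⌉ k) ⟩
  2 + (if odd k then suc k else k)
    ≡⟨ if-float (2 +_) (odd k) ⟩
  (if odd k then 3 + k else 2 + k)
    ≡⟨ cong (if_then 3 + k else 2 + k) (sym (not-involutive (odd k))) ⟩
  (if not (not (odd k)) then 3 + k else 2 + k) ∎
  where open ≡-Reasoning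

sumBelow-odd : ∀ (g : ℕ → ℕ) k →
  sumBelow (suc k) (λ j → if odd j then g j else 0) ≡ sum1 ⌈ k /2⌉ (λ i → g (2 * i ∸ 1))
sumBelow-odd g zero          = refl
sumBelow-odd g (suc zero)    = cong (0 +_) (+-identityʳ (g 1))
sumBelow-odd g (suc (suc k)) = begin
  sumBelow (3 + k) f
    ≡⟨ sumBelow-suc (2 + k) f ⟩
  sumBelow (2 + k) f + f (2 + k)
    ≡⟨ cong (_+ f (2 + k)) (sumBelow-suc (suc k) f) ⟩
  sumBelow (suc k) f + f (suc k) + f (2 + k)
    ≡⟨ +-assoc (sumBelow (suc k) f) _ _ ⟩
  sumBelow (suc k) f + (f (suc k) + f (2 + k))
    ≡⟨ cong₂ _+_ (sumBelow-odd g k) nextOddTerm ⟩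
  sum1 ⌈ k /2⌉ h + g (suc (2 * ⌈ k /2⌉))
    ≡⟨ cong (λ n → sum1 ⌈ k /2⌉ h + g (n ∸ 1)) (sym (*-suc 2 ⌈ k /2⌉)) ⟩
  sum1 ⌈ k /2⌉ h + h (suc ⌈ k /2⌉) ∎
  where
  open ≡-Reasoning
  f : ℕ → ℕ
  f j = if odd j then g j else 0
  h : ℕ → ℕ
  h i = g (2 * i ∸ 1)
  -- of k + 1 and k + 2, exactly one is odd, and it is 2 ⌈k/2⌉ + 1
  nextOddTerm : f (suc k) + f (2 + k) ≡ g (suc (2 * ⌈ k /2⌉))
  nextOddTerm with odd k | twice-⌈/2⌉ k
  ... | false | 2c≡k   = trans (+-identityʳ (g (suc k))) (cong (g ∘ suc) (sym 2c≡k))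
  ... | true  | 2c≡k+1 = cong (g ∘ suc) (sym 2c≡k+1)

nC0≡1 : ∀ n → n C 0 ≡ 1
nC0≡1 zero    = refl
nC0≡1 (suc n) = refl

_==_ : Bool → Bool → Bool
x == y = not (x xor y)

not-== : ∀ x y → not x == y ≡ x == not y
not-== x y = cong not (trans (sym (not-distribˡ-xor x y)) (not-distribʳ-xor x y))

==-true : ∀ x → x == true ≡ x
==-true true  = refl
==-true false = refl

parityTerm : ℕ → ℕ → ℕ → Bool → ℕ → ℕ
parityTerm r b k e j = if odd j == e then (r C j) * (b C (k ∸ j)) else 0

-- The number of k-subsets of r red and b blue points whose number of red points has parity e.
parityCount : ℕ → ℕ → ℕ → Bool → ℕ
parityCount r b k e = sumBelow (suc k) (parityTerm r b k e)

parityCount-zero : ∀ r b e → parityCount r b 0 e ≡ (if not e then 1 else 0)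
parityCount-zero r b e =
  trans (+-identityʳ _) (cong (λ n → if not e then n else 0) (cong₂ _*_ (nC0≡1 r) (nC0≡1 b)))

parityCount-empty : ∀ k e → parityCount 0 0 (suc k) e ≡ 0
parityCount-empty k e = sumBelow-zero (2 + k) (parityTerm 0 0 (suc k) e) termVanishes
  where
  termVanishes : ∀ j → parityTerm 0 0 (suc k) e j ≡ 0
  termVanishes zero    = if-eta (odd 0 == e)
  termVanishes (suc j) = if-eta (odd (suc j) == e)

parityCount-suc-red : ∀ r b k e →
  parityCount (suc r) b (suc k) e ≡ parityCount r b (suc k) e + parityCount r b k (not e)
parityCount-suc-red r b k e = begin
  t′ 0 + sumBelow (suc k) (t′ ∘ suc)
    ≡⟨ cong₂ _+_ firstTerm (sumBelow-cong (suc k) (λ j _ → pascalTerm j)) ⟩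
  t 0 + sumBelow (suc k) (λ j → t (suc j) + u j)
    ≡⟨ cong (t 0 +_) (sumBelow-+ (suc k) (t ∘ suc) u) ⟩
  t 0 + (sumBelow (suc k) (t ∘ suc) + sumBelow (suc k) u)
    ≡⟨ sym (+-assoc (t 0) _ _) ⟩
  parityCount r b (suc k) e + parityCount r b k (not e) ∎
  where
  open ≡-Reasoning
  t t′ u : ℕ → ℕ
  t  = parityTerm r b (suc k) e
  t′ = parityTerm (suc r) b (suc k) e
  u  = parityTerm r b k (not e)
  firstTerm : t′ 0 ≡ t 0
  firstTerm = cong (λ n → if not e then n * (b C suc k) else 0) (trans (nC0≡1 (suc r)) (sym (nC0≡1 r)))
  pascalTerm : ∀ j → t′ (suc j) ≡ t (suc j) + u j
  pascalTerm j rewrite not-== (odd j) e with odd j == not e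
  ... | true  = begin
    (suc r C suc j) * X           ≡⟨ cong (_* X) (sym (nCk+nC[k+1]≡[n+1]C[k+1] r j)) ⟩
    (r C j + r C suc j) * X       ≡⟨ *-distribʳ-+ X (r C j) (r C suc j) ⟩
    (r C j) * X + (r C suc j) * X ≡⟨ +-comm ((r C j) * X) _ ⟩
    (r C suc j) * X + (r C j) * X ∎
    where X = b C (k ∸ j)
  ... | false = refl

parityCount-suc-blue : ∀ r b k e →
  parityCount r (suc b) (suc k) e ≡ parityCount r b (suc k) e + parityCount r b k e
parityCount-suc-blue r b k e = begin
  sumBelow (2 + k) t′
    ≡⟨ sumBelow-suc (suc k) t′ ⟩
  sumBelow (suc k) t′ + t′ (suc k)
    ≡⟨ cong₂ _+_ (sumBelow-cong (suc k) pascalTerm) lastTerm ⟩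
  sumBelow (suc k) (λ j → u j + t j) + t (suc k)
    ≡⟨ cong (_+ t (suc k)) (sumBelow-+ (suc k) u t) ⟩
  parityCount r b k e + sumBelow (suc k) t + t (suc k)
    ≡⟨ +-assoc (parityCount r b k e) _ _ ⟩
  parityCount r b k e + (sumBelow (suc k) t + t (suc k))
    ≡⟨ cong (parityCount r b k e +_) (sym (sumBelow-suc (suc k) t)) ⟩
  parityCount r b k e + parityCount r b (suc k) e
    ≡⟨ +-comm (parityCount r b k e) _ ⟩
  parityCount r b (suc k) e + parityCount r b k e ∎
  where
  open ≡-Reasoning
  t t′ u : ℕ → ℕ
  t  = parityTerm r b (suc k) e
  t′ = parityTerm r (suc b) (suc k) e
  u  = parityTerm r b k e
  pascalTerm : ∀ j → j < suc k → t′ j ≡ u j + t j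
  pascalTerm j (s≤s j≤k) with odd j == e
  ... | true  = begin
    (r C j) * (suc b C (suc k ∸ j))
      ≡⟨ cong (λ n → (r C j) * (suc b C n)) (+-∸-assoc 1 j≤k) ⟩
    (r C j) * (suc b C suc (k ∸ j))
      ≡⟨ cong ((r C j) *_) (sym (nCk+nC[k+1]≡[n+1]C[k+1] b (k ∸ j))) ⟩
    (r C j) * (b C (k ∸ j) + b C suc (k ∸ j))
      ≡⟨ *-distribˡ-+ (r C j) (b C (k ∸ j)) _ ⟩
    (r C j) * (b C (k ∸ j)) + (r C j) * (b C suc (k ∸ j))
      ≡⟨ cong (λ n → (r C j) * (b C (k ∸ j)) + (r C j) * (b C n)) (sym (+-∸-assoc 1 j≤k)) ⟩
    (r C j) * (b C (k ∸ j)) + (r C j) * (b C (suc k ∸ j)) ∎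
  ... | false = refl
  lastTerm : t′ (suc k) ≡ t (suc k)
  lastTerm = cong (λ n → if odd (suc k) == e then (r C suc k) * n else 0) (begin
    suc b C (k ∸ k) ≡⟨ cong (suc b C_) (n∸n≡0 k) ⟩
    suc b C 0       ≡⟨ trans (nC0≡1 (suc b)) (sym (nC0≡1 b)) ⟩
    b C 0           ≡⟨ cong (b C_) (sym (n∸n≡0 k)) ⟩
    b C (k ∸ k)     ∎)

parityCount-odd : ∀ r b k →
  parityCount r b k true ≡ sum1 ⌈ k /2⌉ (λ i → (r C (2 * i ∸ 1)) * (b C (k + 1 ∸ 2 * i)))
parityCount-odd r b k = begin
  parityCount r b k true
    ≡⟨ sumBelow-cong (suc k) (λ j _ → cong (λ c → if c then g j else 0) (==-true (odd j))) ⟩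
  sumBelow (suc k) (λ j → if odd j then g j else 0)
    ≡⟨ sumBelow-odd g k ⟩
  sum1 ⌈ k /2⌉ (λ i → g (2 * i ∸ 1))
    ≡⟨ sum1-cong ⌈ k /2⌉ (λ i → cong (λ n → (r C (2 * suc i ∸ 1)) * (b C (n ∸ 2 * suc i)))
                                    (+-comm 1 k)) ⟩
  sum1 ⌈ k /2⌉ (λ i → (r C (2 * i ∸ 1)) * (b C (k + 1 ∸ 2 * i))) ∎
  where
  open ≡-Reasoning
  g : ℕ → ℕ
  g j = (r C j) * (b C (k ∸ j))

-- The k-subsets of a 2-coloured set, split by parity

xor-cancelˡ : ∀ x y → x xor (x xor y) ≡ y
xor-cancelˡ true  y = not-involutive y
xor-cancelˡ false y = refl

parity : ∀ {n} → Vec Bool n → Subset n → Bool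
parity []       []       = false
parity (c ∷ cs) (s ∷ S) = (c ∧ s) xor parity cs S

parity-inside : ∀ {n} c (cs : Vec Bool n) S → parity (c ∷ cs) (true ∷ S) ≡ c xor parity cs S
parity-inside c cs S = cong (_xor parity cs S) (∧-identityʳ c)

parity-outside : ∀ {n} c (cs : Vec Bool n) S → parity (c ∷ cs) (false ∷ S) ≡ parity cs S
parity-outside c cs S = cong (_xor parity cs S) (∧-zeroʳ c)

#red #blue : ∀ {n} → Vec Bool n → ℕ
#red  []           = 0
#red  (true  ∷ cs) = suc (#red cs)
#red  (false ∷ cs) = #red cs
#blue []           = 0
#blue (true  ∷ cs) = #blue cs
#blue (false ∷ cs) = suc (#blue cs)

subsetsOfParity : ∀ {n} → Vec Bool n → ℕ → Bool → List (Subset n)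
subsetsOfParity []       zero    false = [] ∷ []
subsetsOfParity []       zero    true  = []
subsetsOfParity []       (suc k) e     = []
subsetsOfParity (c ∷ cs) zero    e     = map (false ∷_) (subsetsOfParity cs zero e)
subsetsOfParity (c ∷ cs) (suc k) e     =
  map (false ∷_) (subsetsOfParity cs (suc k) e) ++ₗ map (true ∷_) (subsetsOfParity cs k (c xor e))

∈-subsetsOfParity⁻ : ∀ {n} (cs : Vec Bool n) k e {S} →
  S ∈ subsetsOfParity cs k e → ∣ S ∣ ≡ k × parity cs S ≡ e
∈-subsetsOfParity⁻ []       zero    false (here refl) = refl , refl
∈-subsetsOfParity⁻ (c ∷ cs) zero    e     S∈ with ∈-map⁻ (false ∷_) S∈
... | S , S∈′ , refl with ∈-subsetsOfParity⁻ cs zero e S∈′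
...   | size , par = size , trans (parity-outside c cs S) par
∈-subsetsOfParity⁻ (c ∷ cs) (suc k) e     S∈
  with ∈-++⁻ (map (false ∷_) (subsetsOfParity cs (suc k) e)) S∈
... | inj₁ S∈ˡ with ∈-map⁻ (false ∷_) S∈ˡ
...   | S , S∈′ , refl with ∈-subsetsOfParity⁻ cs (suc k) e S∈′
...     | size , par = size , trans (parity-outside c cs S) par
∈-subsetsOfParity⁻ (c ∷ cs) (suc k) e     S∈ | inj₂ S∈ʳ with ∈-map⁻ (true ∷_) S∈ʳ
...   | S , S∈′ , refl with ∈-subsetsOfParity⁻ cs k (c xor e) S∈′
...     | size , par =
  cong suc size , trans (parity-inside c cs S) (trans (cong (c xor_) par) (xor-cancelˡ c e))

∈-subsetsOfParity⁺ : ∀ {n} (cs : Vec Bool n) k e (S : Subset n) →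
  ∣ S ∣ ≡ k → parity cs S ≡ e → S ∈ subsetsOfParity cs k e
∈-subsetsOfParity⁺ []       zero    false []        refl refl = here refl
∈-subsetsOfParity⁺ (c ∷ cs) zero    e     (false ∷ S) size par =
  ∈-map⁺ (false ∷_) (∈-subsetsOfParity⁺ cs zero e S size (trans (sym (parity-outside c cs S)) par))
∈-subsetsOfParity⁺ (c ∷ cs) (suc k) e     (false ∷ S) size par =
  ∈-++⁺ˡ (∈-map⁺ (false ∷_)
    (∈-subsetsOfParity⁺ cs (suc k) e S size (trans (sym (parity-outside c cs S)) par)))
∈-subsetsOfParity⁺ (c ∷ cs) (suc k) e     (true ∷ S)  size par =
  ∈-++⁺ʳ (map (false ∷_) (subsetsOfParity cs (suc k) e))
    (∈-map⁺ (true ∷_) (∈-subsetsOfParity⁺ cs k (c xor e) S (suc-injective size) parS))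
  where
  parS : parity cs S ≡ c xor e
  parS = trans (sym (xor-cancelˡ c (parity cs S))) (cong (c xor_) (trans (sym (parity-inside c cs S)) par))

subsetsOfParity-unique : ∀ {n} (cs : Vec Bool n) k e → Unique (subsetsOfParity cs k e)
subsetsOfParity-unique []       zero    false = [] ∷ []
subsetsOfParity-unique []       zero    true  = []
subsetsOfParity-unique []       (suc k) e     = []
subsetsOfParity-unique (c ∷ cs) zero    e     = Unique.map⁺ ∷-injectiveʳ (subsetsOfParity-unique cs zero e)
subsetsOfParity-unique (c ∷ cs) (suc k) e     =
  Unique.++⁺ (Unique.map⁺ ∷-injectiveʳ (subsetsOfParity-unique cs (suc k) e))
             (Unique.map⁺ ∷-injectiveʳ (subsetsOfParity-unique cs k (c xor e)))
             headsDiffer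
  where
  headsDiffer : ∀ {S} → ¬ (S ∈ map (false ∷_) (subsetsOfParity cs (suc k) e)
                          × S ∈ map (true ∷_) (subsetsOfParity cs k (c xor e)))
  headsDiffer (S∈ˡ , S∈ʳ) with ∈-map⁻ (false ∷_) S∈ˡ | ∈-map⁻ (true ∷_) S∈ʳ
  ... | _ , _ , refl | _ , _ , ()

length-map-++ : ∀ {n} (X Y : List (Subset n)) →
  length (map (false ∷_) X ++ₗ map (true ∷_) Y) ≡ length X + length Y
length-map-++ X Y = trans (length-++ (map (false ∷_) X)) (cong₂ _+_ (length-map _ X) (length-map _ Y))

length-subsetsOfParity : ∀ {n} (cs : Vec Bool n) k e →
  length (subsetsOfParity cs k e) ≡ parityCount (#red cs) (#blue cs) k e
length-subsetsOfParity []       zero    false = refl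
length-subsetsOfParity []       zero    true  = refl
length-subsetsOfParity []       (suc k) e     = sym (parityCount-empty k e)
length-subsetsOfParity (c ∷ cs) zero    e     = begin
  length (map (false ∷_) (subsetsOfParity cs zero e))
    ≡⟨ length-map _ (subsetsOfParity cs zero e) ⟩
  length (subsetsOfParity cs zero e)
    ≡⟨ length-subsetsOfParity cs zero e ⟩
  parityCount (#red cs) (#blue cs) 0 e
    ≡⟨ parityCount-zero (#red cs) (#blue cs) e ⟩
  (if not e then 1 else 0)
    ≡⟨ sym (parityCount-zero (#red (c ∷ cs)) (#blue (c ∷ cs)) e) ⟩
  parityCount (#red (c ∷ cs)) (#blue (c ∷ cs)) 0 e ∎
  where open ≡-Reasoning
length-subsetsOfParity (true ∷ cs) (suc k) e  =
  trans (length-map-++ (subsetsOfParity cs (suc k) e) _)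
        (trans (cong₂ _+_ (length-subsetsOfParity cs (suc k) e) (length-subsetsOfParity cs k (not e)))
               (sym (parityCount-suc-red (#red cs) (#blue cs) k e)))
length-subsetsOfParity (false ∷ cs) (suc k) e =
  trans (length-map-++ (subsetsOfParity cs (suc k) e) _)
        (trans (cong₂ _+_ (length-subsetsOfParity cs (suc k) e) (length-subsetsOfParity cs k e))
               (sym (parityCount-suc-blue (#red cs) (#blue cs) k e)))

+-xor-invariant : ∀ c (f : Bool → ℕ) → f (c xor true) + f (c xor false) ≡ f true + f false
+-xor-invariant true  f = +-comm (f false) (f true)
+-xor-invariant false f = refl

length-subsetsOfParity-both : ∀ {n} (cs : Vec Bool n) k →
  length (subsetsOfParity cs k true) + length (subsetsOfParity cs k false) ≡ n C k
length-subsetsOfParity-both []       zero    = refl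
length-subsetsOfParity-both []       (suc k) = refl
length-subsetsOfParity-both {suc n} (c ∷ cs) zero = begin
  length (map (false ∷_) (subsetsOfParity cs zero true))
    + length (map (false ∷_) (subsetsOfParity cs zero false))
    ≡⟨ cong₂ _+_ (length-map _ (subsetsOfParity cs zero true))
                 (length-map _ (subsetsOfParity cs zero false)) ⟩
  length (subsetsOfParity cs zero true) + length (subsetsOfParity cs zero false)
    ≡⟨ length-subsetsOfParity-both cs zero ⟩
  n C 0
    ≡⟨ trans (nC0≡1 n) (sym (nC0≡1 (suc n))) ⟩
  suc n C 0 ∎
  where open ≡-Reasoning
length-subsetsOfParity-both {suc n} (c ∷ cs) (suc k) = begin
  length (subsetsOfParity (c ∷ cs) (suc k) true) + length (subsetsOfParity (c ∷ cs) (suc k) false)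
    ≡⟨ cong₂ _+_ (length-map-++ (subsetsOfParity cs (suc k) true) _)
                 (length-map-++ (subsetsOfParity cs (suc k) false) _) ⟩
  (A true + B (c xor true)) + (A false + B (c xor false))
    ≡⟨ +-interchange (A true) _ (A false) _ ⟩
  (A true + A false) + (B (c xor true) + B (c xor false))
    ≡⟨ cong₂ _+_ (length-subsetsOfParity-both cs (suc k))
                 (trans (+-xor-invariant c B) (length-subsetsOfParity-both cs k)) ⟩
  n C suc k + n C k
    ≡⟨ +-comm (n C suc k) (n C k) ⟩
  n C k + n C suc k
    ≡⟨ nCk+nC[k+1]≡[n+1]C[k+1] n k ⟩
  suc n C suc k ∎
  where
  open ≡-Reasoning
  A B : Bool → ℕ
  A e = length (subsetsOfParity cs (suc k) e)
  B e = length (subsetsOfParity cs k e)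

-- Token graphs of properly 2-coloured graphs

∷-⊖-∷ : ∀ {n} a b (A B : Subset n) → (a ∷ A) ⊖ (b ∷ B) ≡ (a xor b) ∷ (A ⊖ B)
∷-⊖-∷ true  true  A B = refl
∷-⊖-∷ true  false A B = refl
∷-⊖-∷ false true  A B = refl
∷-⊖-∷ false false A B = refl

⊖-self : ∀ {n} (A : Subset n) → A ⊖ A ≡ ⊥
⊖-self []          = refl
⊖-self (true ∷ A)  = cong (false ∷_) (⊖-self A)
⊖-self (false ∷ A) = cong (false ∷_) (⊖-self A)

parity-⊖ : ∀ {n} (cs : Vec Bool n) A B → parity cs (A ⊖ B) ≡ parity cs A xor parity cs B
parity-⊖ []       []      []      = refl
parity-⊖ (c ∷ cs) (a ∷ A) (b ∷ B) = begin
  parity (c ∷ cs) ((a ∷ A) ⊖ (b ∷ B))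
    ≡⟨ cong (parity (c ∷ cs)) (∷-⊖-∷ a b A B) ⟩
  (c ∧ (a xor b)) xor parity cs (A ⊖ B)
    ≡⟨ cong₂ _xor_ (∧-distribˡ-xor c a b) (parity-⊖ cs A B) ⟩
  ((c ∧ a) xor (c ∧ b)) xor (parity cs A xor parity cs B)
    ≡⟨ xor-interchange (c ∧ a) (c ∧ b) _ _ ⟩
  ((c ∧ a) xor parity cs A) xor ((c ∧ b) xor parity cs B) ∎
  where open ≡-Reasoning

parity-⊥ : ∀ {n} (cs : Vec Bool n) → parity cs ⊥ ≡ false
parity-⊥ []       = refl
parity-⊥ (c ∷ cs) = trans (parity-outside c cs ⊥) (parity-⊥ cs)

parity-⁅⁆ : ∀ {n} (cs : Vec Bool n) u → parity cs ⁅ u ⁆ ≡ lookup cs u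
parity-⁅⁆ (c ∷ cs) zero    =
  trans (parity-inside c cs ⊥) (trans (cong (c xor_) (parity-⊥ cs)) (xor-identityʳ c))
parity-⁅⁆ (c ∷ cs) (suc u) = trans (parity-outside c cs ⁅ u ⁆) (parity-⁅⁆ cs u)

parity-⁅⁆∪⁅⁆ : ∀ {n} (cs : Vec Bool n) u v → u ≢ v →
  parity cs (⁅ u ⁆ ∪ ⁅ v ⁆) ≡ lookup cs u xor lookup cs v
parity-⁅⁆∪⁅⁆ (c ∷ cs) zero    zero    u≢v = ⊥-elim (u≢v refl)
parity-⁅⁆∪⁅⁆ (c ∷ cs) zero    (suc v) _   =
  trans (parity-inside c cs (⊥ ∪ ⁅ v ⁆))
        (cong (c xor_) (trans (cong (parity cs) (∪-identityˡ ⁅ v ⁆)) (parity-⁅⁆ cs v)))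
parity-⁅⁆∪⁅⁆ (c ∷ cs) (suc u) zero    _   =
  trans (parity-inside c cs (⁅ u ⁆ ∪ ⊥))
        (trans (cong (c xor_) (trans (cong (parity cs) (∪-identityʳ ⁅ u ⁆)) (parity-⁅⁆ cs u))) (xor-comm c _))
parity-⁅⁆∪⁅⁆ (c ∷ cs) (suc u) (suc v) u≢v =
  trans (parity-outside c cs (⁅ u ⁆ ∪ ⁅ v ⁆)) (parity-⁅⁆∪⁅⁆ cs u v (u≢v ∘ cong suc))

ProperColouring : ∀ {n} → Graph n → Vec Bool n → Set
ProperColouring G cs = ∀ u v → G u v → lookup cs u ≡ not (lookup cs v)

xor≡true⇒≡not : ∀ {x y} → x xor y ≡ true → x ≡ not y
xor≡true⇒≡not {true}  {false} _ = refl
xor≡true⇒≡not {false} {true}  _ = refl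

tokenAdj⇒opposite-parity : ∀ {n} {G : Graph n} cs → ProperColouring G cs →
  ∀ {A B} → TokenAdj G A B → parity cs A ≡ not (parity cs B)
tokenAdj⇒opposite-parity cs proper {A} {B} (u , v , uv , A⊖B≡uv) = xor≡true⇒≡not (begin
  parity cs A xor parity cs B       ≡⟨ parity-⊖ cs A B ⟨
  parity cs (A ⊖ B)                 ≡⟨ cong (parity cs) A⊖B≡uv ⟩
  parity cs (⁅ u ⁆ ∪ ⁅ v ⁆)         ≡⟨ parity-⁅⁆∪⁅⁆ cs u v u≢v ⟩
  lookup cs u xor lookup cs v       ≡⟨ cong (_xor lookup cs v) (proper u v uv) ⟩
  not (lookup cs v) xor lookup cs v ≡⟨ xor-inverseˡ (lookup cs v) ⟩
  true                              ∎)
  where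
  open ≡-Reasoning
  u≢v : u ≢ v
  u≢v refl = not-¬ refl (proper u u uv)

∈-─⁺ : ∀ {A : Set} {x z : A} {ys} (x∈ys : x ∈ ys) → z ∈ ys → z ≢ x → z ∈ (ys ─ x∈ys)
∈-─⁺ (here refl) (here refl) z≢x = ⊥-elim (z≢x refl)
∈-─⁺ (here refl) (there z∈)  _   = z∈
∈-─⁺ (there x∈)  (here refl) _   = here refl
∈-─⁺ (there x∈)  (there z∈)  z≢x = there (∈-─⁺ x∈ z∈ z≢x)

pigeonhole : ∀ {A B : Set} (f : A → B) {xs : List A} {ys : List B} → Unique xs →
  (∀ {x y} → x ∈ xs → y ∈ xs → f x ≡ f y → x ≡ y) →
  (∀ {x} → x ∈ xs → f x ∈ ys) → length xs ≤ length ys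
pigeonhole f {[]}              _                _   _    = z≤n
pigeonhole f {x ∷ xs} {ys} (x∉xs ∷ unique) inj into = begin
  suc (length xs)
    ≤⟨ s≤s (pigeonhole f unique (λ x∈ y∈ → inj (there x∈) (there y∈)) intoRest) ⟩
  suc (length (ys ─ fx∈ys))
    ≡⟨ length-removeAt′ ys _ ⟨
  length ys ∎
  where
  open ≤-Reasoning
  fx∈ys : f x ∈ ys
  fx∈ys = into (here refl)
  intoRest : ∀ {y} → y ∈ xs → f y ∈ (ys ─ fx∈ys)
  intoRest y∈ = ∈-─⁺ fx∈ys (into (there y∈)) λ fy≡fx →
    All.lookup x∉xs y∈ (sym (inj (there y∈) (here refl) fy≡fx))

record MatchedBy {n} (G : Graph n) (σ : Subset n → Subset n) (S : Subset n) : Set where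
  field
    adjacent   : TokenAdj G S (σ S)
    involutive : σ (σ S) ≡ S
    sameSize   : ∣ σ S ∣ ≡ ∣ S ∣

⊔-attained : ∀ (f : Bool → ℕ) e → f (not e) ≤ f e → f true ⊔ f false ≡ f e
⊔-attained f true  f≤ = m≥n⇒m⊔n≡m f≤
⊔-attained f false f≤ = m≤n⇒m⊔n≡n f≤

module ParityClasses {p} {G : Graph p} {cs : Vec Bool p} (proper : ProperColouring G cs) (k : ℕ) where

  parityClass : Bool → List (Subset p)
  parityClass = subsetsOfParity cs k

  parityClass-independent : ∀ e → IndependentTokenSet G k (parityClass e)
  parityClass-independent e = record
    { unique = subsetsOfParity-unique cs k e
    ; sizes  = All.tabulate (λ S∈ → proj₁ (∈-subsetsOfParity⁻ cs k e S∈))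
    ; nonAdj = λ A∈ B∈ A~B → not-¬ refl (begin
        e                 ≡⟨ proj₂ (∈-subsetsOfParity⁻ cs k e A∈) ⟨
        parity cs _       ≡⟨ tokenAdj⇒opposite-parity cs proper A~B ⟩
        not (parity cs _) ≡⟨ cong not (proj₂ (∈-subsetsOfParity⁻ cs k e B∈)) ⟩
        not e             ∎)
    }
    where open ≡-Reasoning

  module Saturated (e : Bool) (σ : Subset p → Subset p)
                   (matched : ∀ S → ∣ S ∣ ≡ k → parity cs S ≡ not e → MatchedBy G σ S) where

    toClass : Subset p → Subset p
    toClass S with parity cs S ≟ e
    ... | yes _ = S
    ... | no  _ = σ S

    module _ {L : List (Subset p)} (I : IndependentTokenSet G k L) where
      open IndependentTokenSet I

      size∈ : ∀ {S} → S ∈ L → ∣ S ∣ ≡ k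
      size∈ = All.lookup sizes

      matched∈ : ∀ {S} → S ∈ L → parity cs S ≢ e → MatchedBy G σ S
      matched∈ {S} S∈ S≢e = matched S (size∈ S∈) (¬-not S≢e)

      toClass∈ : ∀ {S} → S ∈ L → toClass S ∈ parityClass e
      toClass∈ {S} S∈ with parity cs S ≟ e
      ... | yes S≡e = ∈-subsetsOfParity⁺ cs k e S (size∈ S∈) S≡e
      ... | no  S≢e =
        ∈-subsetsOfParity⁺ cs k e (σ S) (trans sameSize (size∈ S∈)) (not-injective (begin
        not (parity cs (σ S)) ≡⟨ tokenAdj⇒opposite-parity cs proper adjacent ⟨
        parity cs S           ≡⟨ ¬-not S≢e ⟩
        not e                 ∎))
        where
        open ≡-Reasoning
        open MatchedBy (matched∈ S∈ S≢e)

      toClass-injective : ∀ {A B} → A ∈ L → B ∈ L → toClass A ≡ toClass B → A ≡ B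
      toClass-injective {A} {B} A∈ B∈ eq with parity cs A ≟ e | parity cs B ≟ e
      ... | yes _   | yes _   = eq
      ... | yes _   | no  B≢e =
        ⊥-elim (nonAdj B∈ A∈ (subst (TokenAdj G B) (sym eq) (MatchedBy.adjacent (matched∈ B∈ B≢e))))
      ... | no  A≢e | yes _   =
        ⊥-elim (nonAdj A∈ B∈ (subst (TokenAdj G A) eq (MatchedBy.adjacent (matched∈ A∈ A≢e))))
      ... | no  A≢e | no  B≢e = begin
        A       ≡⟨ MatchedBy.involutive (matched∈ A∈ A≢e) ⟨
        σ (σ A) ≡⟨ cong σ eq ⟩
        σ (σ B) ≡⟨ MatchedBy.involutive (matched∈ B∈ B≢e) ⟩
        B       ∎
        where open ≡-Reasoning

      independent-length≤ : length L ≤ length (parityClass e)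
      independent-length≤ = pigeonhole toClass unique toClass-injective toClass∈

    independenceNumber : IndependenceNumberTok G k (length (parityClass true) ⊔ length (parityClass false))
    independenceNumber
      rewrite ⊔-attained (length ∘ parityClass) e (independent-length≤ (parityClass-independent (not e))) =
      (parityClass e , parityClass-independent e , refl) , λ _ → independent-length≤

-- The parity of the red count of a k-set meeting every matched pair of vertices in 0 or 2 points.
majorityParity : ℕ → Bool
majorityParity k = odd ⌈ k /2⌉

record TokenCertificate {p} (G : Graph p) : Set where
  field
    colouring : Vec Bool p
    proper    : ProperColouring G colouring
    #red≡     : #red colouring ≡ ⌈ p /2⌉
    #blue≡    : #blue colouring ≡ ⌊ p /2⌋
    partner   : Subset p → Subset p
    matched   : ∀ S → parity colouring S ≡ not (majorityParity ∣ S ∣) → MatchedBy G partner S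

independenceNumber-rVal : ∀ {p} {G : Graph p} → TokenCertificate G →
  ∀ k → IndependenceNumberTok G k (rVal p k ⊔ ((p C k) ∸ rVal p k))
independenceNumber-rVal {p} {G} cert k =
  subst (IndependenceNumberTok G k) (sym (cong₂ _⊔_ rVal≡ complement≡))
    (Saturated.independenceNumber (majorityParity k) partner matchedₖ)
  where
  open TokenCertificate cert
  open ParityClasses {cs = colouring} proper k
  open ≡-Reasoning
  rVal≡ : rVal p k ≡ length (parityClass true)
  rVal≡ = begin
    rVal p k
      ≡⟨ parityCount-odd ⌈ p /2⌉ ⌊ p /2⌋ k ⟨
    parityCount ⌈ p /2⌉ ⌊ p /2⌋ k true
      ≡⟨ cong₂ (λ r b → parityCount r b k true) #red≡ #blue≡ ⟨
    parityCount (#red colouring) (#blue colouring) k true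
      ≡⟨ length-subsetsOfParity colouring k true ⟨
    length (parityClass true) ∎
  complement≡ : (p C k) ∸ rVal p k ≡ length (parityClass false)
  complement≡ = begin
    (p C k) ∸ rVal p k
      ≡⟨ cong₂ _∸_ (length-subsetsOfParity-both colouring k) (sym rVal≡) ⟨
    length (parityClass true) + length (parityClass false) ∸ length (parityClass true)
      ≡⟨ m+n∸m≡n (length (parityClass true)) _ ⟩
    length (parityClass false) ∎
  matchedₖ : ∀ S → ∣ S ∣ ≡ k → parity colouring S ≡ not (majorityParity k) → MatchedBy G partner S
  matchedₖ S |S|≡k S-minority = matched S (trans S-minority (cong (not ∘ majorityParity) (sym |S|≡k)))

-- Paths

alternating : ∀ n → Vec Bool n
alternating zero          = []
alternating (suc zero)    = true ∷ []
alternating (suc (suc n)) = true ∷ false ∷ alternating n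

#red-alternating : ∀ n → #red (alternating n) ≡ ⌈ n /2⌉
#red-alternating zero          = refl
#red-alternating (suc zero)    = refl
#red-alternating (suc (suc n)) = cong suc (#red-alternating n)

#blue-alternating : ∀ n → #blue (alternating n) ≡ ⌊ n /2⌋
#blue-alternating zero          = refl
#blue-alternating (suc zero)    = refl
#blue-alternating (suc (suc n)) = cong suc (#blue-alternating n)

lookup-alternating : ∀ n (u : Fin n) → lookup (alternating n) u ≡ not (odd (toℕ u))
lookup-alternating (suc zero)    zero          = refl
lookup-alternating (suc (suc n)) zero          = refl
lookup-alternating (suc (suc n)) (suc zero)    = refl
lookup-alternating (suc (suc n)) (suc (suc u)) =
  trans (lookup-alternating n u) (cong not (sym (not-involutive (odd (toℕ u)))))

alternating-proper : ∀ n → ProperColouring (pathGraph n) (alternating n)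
alternating-proper n u v (inj₁ v≡u+1) rewrite lookup-alternating n u | lookup-alternating n v | v≡u+1 =
  cong not (sym (not-involutive (odd (toℕ u))))
alternating-proper n u v (inj₂ u≡v+1) rewrite lookup-alternating n u | lookup-alternating n v | u≡v+1 = refl

pathPartner : ∀ {n} → Subset n → Subset n
pathPartner []                  = []
pathPartner (x ∷ [])            = x ∷ []
pathPartner (true  ∷ false ∷ S) = false ∷ true  ∷ S
pathPartner (false ∷ true  ∷ S) = true  ∷ false ∷ S
pathPartner (true  ∷ true  ∷ S) = true  ∷ true  ∷ pathPartner S
pathPartner (false ∷ false ∷ S) = false ∷ false ∷ pathPartner S

pathGraph-shift : ∀ {n} {u v : Fin n} → pathGraph n u v → pathGraph (2 + n) (suc (suc u)) (suc (suc v))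
pathGraph-shift = Sum.map (cong λ m → 2 + m) (cong λ m → 2 + m)

⊖-self-⁅0⁆∪⁅1⁆ : ∀ {n} (S : Subset n) → true ∷ true ∷ (S ⊖ S) ≡ ⁅ zero ⁆ ∪ ⁅ suc zero ⁆
⊖-self-⁅0⁆∪⁅1⁆ S = cong (λ D → true ∷ true ∷ D) (trans (⊖-self S) (sym (∪-identityˡ ⊥)))

pathPartner-matched-swap : ∀ {n} x (S : Subset n) → MatchedBy (pathGraph (2 + n)) pathPartner (x ∷ not x ∷ S)
pathPartner-matched-swap true  S = record
  { adjacent = zero , suc zero , inj₁ refl , ⊖-self-⁅0⁆∪⁅1⁆ S ; involutive = refl ; sameSize = refl }
pathPartner-matched-swap false S = record
  { adjacent = zero , suc zero , inj₁ refl , ⊖-self-⁅0⁆∪⁅1⁆ S ; involutive = refl ; sameSize = refl }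

pathPartner-matched-cons : ∀ {n} x {S : Subset n} →
  MatchedBy (pathGraph n) pathPartner S → MatchedBy (pathGraph (2 + n)) pathPartner (x ∷ x ∷ S)
pathPartner-matched-cons true  m = record
  { adjacent   = shiftAdj (MatchedBy.adjacent m)
  ; involutive = cong (λ D → true ∷ true ∷ D) (MatchedBy.involutive m)
  ; sameSize   = cong (2 +_) (MatchedBy.sameSize m)
  }
  where
  shiftAdj : ∀ {A B} → TokenAdj (pathGraph _) A B →
    TokenAdj (pathGraph _) (true ∷ true ∷ A) (true ∷ true ∷ B)
  shiftAdj (u , v , uv , eq) = suc (suc u) , suc (suc v) , pathGraph-shift uv , cong (λ D → false ∷ false ∷ D) eq
pathPartner-matched-cons false m = record
  { adjacent   = shiftAdj (MatchedBy.adjacent m)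
  ; involutive = cong (λ D → false ∷ false ∷ D) (MatchedBy.involutive m)
  ; sameSize   = MatchedBy.sameSize m
  }
  where
  shiftAdj : ∀ {A B} → TokenAdj (pathGraph _) A B →
    TokenAdj (pathGraph _) (false ∷ false ∷ A) (false ∷ false ∷ B)
  shiftAdj (u , v , uv , eq) = suc (suc u) , suc (suc v) , pathGraph-shift uv , cong (λ D → false ∷ false ∷ D) eq

pathPartner-matched : ∀ n (S : Subset n) → parity (alternating n) S ≡ not (majorityParity ∣ S ∣) →
  MatchedBy (pathGraph n) pathPartner S
pathPartner-matched zero          []                  ()
pathPartner-matched (suc zero)    (true  ∷ [])        ()
pathPartner-matched (suc zero)    (false ∷ [])        ()
pathPartner-matched (suc (suc n)) (true  ∷ false ∷ S) _ = pathPartner-matched-swap true  S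
pathPartner-matched (suc (suc n)) (false ∷ true  ∷ S) _ = pathPartner-matched-swap false S
pathPartner-matched (suc (suc n)) (true  ∷ true  ∷ S) minority =
  pathPartner-matched-cons true (pathPartner-matched n S (not-injective minority))
pathPartner-matched (suc (suc n)) (false ∷ false ∷ S) minority =
  pathPartner-matched-cons false (pathPartner-matched n S minority)

pathCertificate : ∀ t → TokenCertificate (pathGraph t)
pathCertificate t = record
  { colouring = alternating t
  ; proper    = alternating-proper t
  ; #red≡     = #red-alternating t
  ; #blue≡    = #blue-alternating t
  ; partner   = pathPartner
  ; matched   = pathPartner-matched t
  }

-- Complete bipartite graphs K_{a,b} with b ∈ {a, a + 1}

data Balanced : ℕ → ℕ → Set where
  balanced-0   : Balanced 0 0
  balanced-1   : Balanced 0 1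
  balanced-suc : ∀ {m n} → Balanced m n → Balanced (suc m) (suc n)

balanced-≡ : ∀ t → Balanced t t
balanced-≡ zero    = balanced-0
balanced-≡ (suc t) = balanced-suc (balanced-≡ t)

balanced-suc-≡ : ∀ t → Balanced t (suc t)
balanced-suc-≡ zero    = balanced-1
balanced-suc-≡ (suc t) = balanced-suc (balanced-suc-≡ t)

swapFirstDifference : ∀ {m n} → Subset m → Subset n → Subset m × Subset n
swapFirstDifference []           ys           = [] , ys
swapFirstDifference (x ∷ xs)     []           = x ∷ xs , []
swapFirstDifference (true  ∷ xs) (false ∷ ys) = false ∷ xs , true  ∷ ys
swapFirstDifference (false ∷ xs) (true  ∷ ys) = true  ∷ xs , false ∷ ys
swapFirstDifference (true  ∷ xs) (true  ∷ ys) = Product.map (true  ∷_) (true  ∷_) (swapFirstDifference xs ys)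
swapFirstDifference (false ∷ xs) (false ∷ ys) = Product.map (false ∷_) (false ∷_) (swapFirstDifference xs ys)

SwapsOnePair : ∀ {m n} → Subset m → Subset n → Set
SwapsOnePair xs ys = let (xs′ , ys′) = swapFirstDifference xs ys in
  (∃ λ i → xs ⊖ xs′ ≡ ⁅ i ⁆) × (∃ λ j → ys ⊖ ys′ ≡ ⁅ j ⁆)
  × swapFirstDifference xs′ ys′ ≡ (xs , ys) × ∣ xs′ ∣ + ∣ ys′ ∣ ≡ ∣ xs ∣ + ∣ ys ∣

swapFirstDifference-swaps : ∀ {m n} → Balanced m n → (xs : Subset m) (ys : Subset n) →
  parity (replicate n true) ys ≡ not (majorityParity (∣ xs ∣ + ∣ ys ∣)) → SwapsOnePair xs ys
swapFirstDifference-swaps balanced-0 [] [] ()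
swapFirstDifference-swaps balanced-1 [] (true  ∷ []) ()
swapFirstDifference-swaps balanced-1 [] (false ∷ []) ()
swapFirstDifference-swaps (balanced-suc _) (true ∷ xs) (false ∷ ys) _ =
  (zero , cong (true ∷_) (⊖-self xs)) , (zero , cong (true ∷_) (⊖-self ys)) , refl , +-suc ∣ xs ∣ ∣ ys ∣
swapFirstDifference-swaps (balanced-suc _) (false ∷ xs) (true ∷ ys) _ =
  (zero , cong (true ∷_) (⊖-self xs)) , (zero , cong (true ∷_) (⊖-self ys)) , refl , sym (+-suc ∣ xs ∣ ∣ ys ∣)
swapFirstDifference-swaps (balanced-suc bal) (true ∷ xs) (true ∷ ys) minority
  with swapFirstDifference-swaps bal xs ys
         (not-injective (trans minority (cong (not ∘ majorityParity ∘ suc) (+-suc ∣ xs ∣ ∣ ys ∣))))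
... | (i , xs⊖) , (j , ys⊖) , involutive , sameSize =
  (suc i , cong (false ∷_) xs⊖) , (suc j , cong (false ∷_) ys⊖) ,
  cong (Product.map (true ∷_) (true ∷_)) involutive ,
  trans (cong suc (+-suc _ _)) (trans (cong (2 +_) sameSize) (sym (cong suc (+-suc ∣ xs ∣ ∣ ys ∣))))
swapFirstDifference-swaps (balanced-suc bal) (false ∷ xs) (false ∷ ys) minority
  with swapFirstDifference-swaps bal xs ys minority
... | (i , xs⊖) , (j , ys⊖) , involutive , sameSize =
  (suc i , cong (false ∷_) xs⊖) , (suc j , cong (false ∷_) ys⊖) ,
  cong (Product.map (false ∷_) (false ∷_)) involutive , sameSize

parity-++ : ∀ {m n} (cs : Vec Bool m) (ds : Vec Bool n) (xs : Subset m) (ys : Subset n) →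
  parity (cs ++ ds) (xs ++ ys) ≡ parity cs xs xor parity ds ys
parity-++ []       ds []       ys = refl
parity-++ (c ∷ cs) ds (x ∷ xs) ys =
  trans (cong ((c ∧ x) xor_) (parity-++ cs ds xs ys)) (sym (xor-assoc (c ∧ x) _ _))

parity-replicate-false : ∀ {m} (xs : Subset m) → parity (replicate m false) xs ≡ false
parity-replicate-false []       = refl
parity-replicate-false (x ∷ xs) = parity-replicate-false xs

∣++∣ : ∀ {m n} (xs : Subset m) (ys : Subset n) → ∣ xs ++ ys ∣ ≡ ∣ xs ∣ + ∣ ys ∣
∣++∣ []           ys = refl
∣++∣ (true  ∷ xs) ys = cong suc (∣++∣ xs ys)
∣++∣ (false ∷ xs) ys = ∣++∣ xs ys

++-⊖-++ : ∀ {m n} (xs xs′ : Subset m) (ys ys′ : Subset n) →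
  (xs ++ ys) ⊖ (xs′ ++ ys′) ≡ (xs ⊖ xs′) ++ (ys ⊖ ys′)
++-⊖-++ []       []         ys ys′ = refl
++-⊖-++ (x ∷ xs) (x′ ∷ xs′) ys ys′ = cong (_ ∷_) (++-⊖-++ xs xs′ ys ys′)

⁅↑ʳ⁆ : ∀ m {n} (j : Fin n) → ⁅ m ↑ʳ j ⁆ ≡ ⊥ ++ ⁅ j ⁆
⁅↑ʳ⁆ zero    j = refl
⁅↑ʳ⁆ (suc m) j = cong (false ∷_) (⁅↑ʳ⁆ m j)

⁅↑ˡ⁆∪⁅↑ʳ⁆ : ∀ {m n} (i : Fin m) (j : Fin n) → ⁅ i ↑ˡ n ⁆ ∪ ⁅ m ↑ʳ j ⁆ ≡ ⁅ i ⁆ ++ ⁅ j ⁆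
⁅↑ˡ⁆∪⁅↑ʳ⁆ {suc m} zero    j = cong (true ∷_) (trans (∪-identityˡ ⁅ m ↑ʳ j ⁆) (⁅↑ʳ⁆ m j))
⁅↑ˡ⁆∪⁅↑ʳ⁆ {suc m} (suc i) j = cong (false ∷_) (⁅↑ˡ⁆∪⁅↑ʳ⁆ i j)

take-++ : ∀ {A : Set} m {n} (xs : Vec A m) (ys : Vec A n) → take m (xs ++ ys) ≡ xs
take-++ m xs ys = ++-injectiveˡ (take m (xs ++ ys)) xs (take++drop≡id m (xs ++ ys))

drop-++ : ∀ {A : Set} m {n} (xs : Vec A m) (ys : Vec A n) → drop m (xs ++ ys) ≡ ys
drop-++ m xs ys = ++-injectiveʳ (take m (xs ++ ys)) xs (take++drop≡id m (xs ++ ys))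

bipartiteColouring : ∀ a b → Vec Bool (a + b)
bipartiteColouring a b = replicate a false ++ replicate b true

#red-bipartiteColouring : ∀ a b → #red (bipartiteColouring a b) ≡ b
#red-bipartiteColouring (suc a) b       = #red-bipartiteColouring a b
#red-bipartiteColouring zero    zero    = refl
#red-bipartiteColouring zero    (suc b) = cong suc (#red-bipartiteColouring zero b)

#blue-bipartiteColouring : ∀ a b → #blue (bipartiteColouring a b) ≡ a
#blue-bipartiteColouring (suc a) b       = cong suc (#blue-bipartiteColouring a b)
#blue-bipartiteColouring zero    zero    = refl
#blue-bipartiteColouring zero    (suc b) = #blue-bipartiteColouring zero b

lookup-bipartiteColouring-< : ∀ a b (u : Fin (a + b)) → toℕ u < a →
  lookup (bipartiteColouring a b) u ≡ false
lookup-bipartiteColouring-< (suc a) b zero    _         = refl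
lookup-bipartiteColouring-< (suc a) b (suc u) (s≤s u<a) = lookup-bipartiteColouring-< a b u u<a

lookup-bipartiteColouring-≥ : ∀ a b (u : Fin (a + b)) → a ≤ toℕ u →
  lookup (bipartiteColouring a b) u ≡ true
lookup-bipartiteColouring-≥ zero    b u       _         = lookup-replicate u true
lookup-bipartiteColouring-≥ (suc a) b (suc u) (s≤s a≤u) = lookup-bipartiteColouring-≥ a b u a≤u

bipartiteColouring-proper : ∀ a b → ProperColouring (completeBipartite a b) (bipartiteColouring a b)
bipartiteColouring-proper a b u v (inj₁ (u<a , a≤v))
  rewrite lookup-bipartiteColouring-< a b u u<a | lookup-bipartiteColouring-≥ a b v a≤v = refl
bipartiteColouring-proper a b u v (inj₂ (v<a , a≤u))
  rewrite lookup-bipartiteColouring-< a b v v<a | lookup-bipartiteColouring-≥ a b u a≤u = refl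

parity-bipartiteColouring-++ : ∀ a b (xs : Subset a) (ys : Subset b) →
  parity (bipartiteColouring a b) (xs ++ ys) ≡ parity (replicate b true) ys
parity-bipartiteColouring-++ a b xs ys =
  trans (parity-++ (replicate a false) (replicate b true) xs ys)
        (cong (_xor parity (replicate b true) ys) (parity-replicate-false xs))

bipartitePartner : ∀ a {b} → Subset (a + b) → Subset (a + b)
bipartitePartner a S = uncurry _++_ (swapFirstDifference (take a S) (drop a S))

bipartitePartner-++ : ∀ a {b} (xs : Subset a) (ys : Subset b) →
  bipartitePartner a (xs ++ ys) ≡ uncurry _++_ (swapFirstDifference xs ys)
bipartitePartner-++ a xs ys rewrite take-++ a xs ys | drop-++ a xs ys = refl

bipartitePartner-matched-++ : ∀ {a b} → Balanced a b → (xs : Subset a) (ys : Subset b) →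
  parity (bipartiteColouring a b) (xs ++ ys) ≡ not (majorityParity ∣ xs ++ ys ∣) →
  MatchedBy (completeBipartite a b) (bipartitePartner a) (xs ++ ys)
bipartitePartner-matched-++ {a} {b} bal xs ys minority
  with swapFirstDifference-swaps bal xs ys
         (trans (sym (parity-bipartiteColouring-++ a b xs ys))
                (trans minority (cong (not ∘ majorityParity) (∣++∣ xs ys))))
... | (i , xs⊖) , (j , ys⊖) , involutive , sameSize = record
  { adjacent   = i ↑ˡ b , a ↑ʳ j , inj₁ (i↑ˡb<a , a≤a↑ʳj) , (begin
      (xs ++ ys) ⊖ bipartitePartner a (xs ++ ys)
        ≡⟨ cong ((xs ++ ys) ⊖_) (bipartitePartner-++ a xs ys) ⟩
      (xs ++ ys) ⊖ (xs′ ++ ys′)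
        ≡⟨ ++-⊖-++ xs xs′ ys ys′ ⟩
      (xs ⊖ xs′) ++ (ys ⊖ ys′)
        ≡⟨ cong₂ _++_ xs⊖ ys⊖ ⟩
      ⁅ i ⁆ ++ ⁅ j ⁆
        ≡⟨ ⁅↑ˡ⁆∪⁅↑ʳ⁆ i j ⟨
      ⁅ i ↑ˡ b ⁆ ∪ ⁅ a ↑ʳ j ⁆ ∎)
  ; involutive = begin
      bipartitePartner a (bipartitePartner a (xs ++ ys))
        ≡⟨ cong (bipartitePartner a) (bipartitePartner-++ a xs ys) ⟩
      bipartitePartner a (xs′ ++ ys′)
        ≡⟨ bipartitePartner-++ a xs′ ys′ ⟩
      uncurry _++_ (swapFirstDifference xs′ ys′)
        ≡⟨ cong (uncurry _++_) involutive ⟩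
      xs ++ ys ∎
  ; sameSize   = begin
      ∣ bipartitePartner a (xs ++ ys) ∣ ≡⟨ cong ∣_∣ (bipartitePartner-++ a xs ys) ⟩
      ∣ xs′ ++ ys′ ∣                    ≡⟨ ∣++∣ xs′ ys′ ⟩
      ∣ xs′ ∣ + ∣ ys′ ∣                 ≡⟨ sameSize ⟩
      ∣ xs ∣ + ∣ ys ∣                   ≡⟨ ∣++∣ xs ys ⟨
      ∣ xs ++ ys ∣                      ∎
  }
  where
  open ≡-Reasoning
  xs′ = proj₁ (swapFirstDifference xs ys)
  ys′ = proj₂ (swapFirstDifference xs ys)
  i↑ˡb<a : toℕ (i ↑ˡ b) < a
  i↑ˡb<a = subst (_< a) (sym (toℕ-↑ˡ i b)) (toℕ<n i)
  a≤a↑ʳj : a ≤ toℕ (a ↑ʳ j)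
  a≤a↑ʳj = ≤-trans (m≤m+n a (toℕ j)) (≤-reflexive (sym (toℕ-↑ʳ a j)))

bipartitePartner-matched : ∀ {a b} → Balanced a b → (S : Subset (a + b)) →
  parity (bipartiteColouring a b) S ≡ not (majorityParity ∣ S ∣) →
  MatchedBy (completeBipartite a b) (bipartitePartner a) S
bipartitePartner-matched {a} {b} bal S =
  subst Goal (take++drop≡id a S) (bipartitePartner-matched-++ bal (take a S) (drop a S))
  where
  Goal : Subset (a + b) → Set
  Goal S = parity (bipartiteColouring a b) S ≡ not (majorityParity ∣ S ∣) →
           MatchedBy (completeBipartite a b) (bipartitePartner a) S

balanced-⌈/2⌉ : ∀ {a b} → Balanced a b → ⌈ a + b /2⌉ ≡ b
balanced-⌈/2⌉ balanced-0 = refl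
balanced-⌈/2⌉ balanced-1 = refl
balanced-⌈/2⌉ {suc a} {suc b} (balanced-suc bal) =
  trans (cong (λ n → ⌈ suc n /2⌉) (+-suc a b)) (cong suc (balanced-⌈/2⌉ bal))

balanced-⌊/2⌋ : ∀ {a b} → Balanced a b → ⌊ a + b /2⌋ ≡ a
balanced-⌊/2⌋ balanced-0 = refl
balanced-⌊/2⌋ balanced-1 = refl
balanced-⌊/2⌋ {suc a} {suc b} (balanced-suc bal) =
  trans (cong (λ n → ⌊ suc n /2⌋) (+-suc a b)) (cong suc (balanced-⌊/2⌋ bal))

bipartiteCertificate : ∀ {a b} → Balanced a b → TokenCertificate (completeBipartite a b)
bipartiteCertificate {a} {b} bal = record
  { colouring = bipartiteColouring a b
  ; proper    = bipartiteColouring-proper a b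
  ; #red≡     = trans (#red-bipartiteColouring a b) (sym (balanced-⌈/2⌉ bal))
  ; #blue≡    = trans (#blue-bipartiteColouring a b) (sym (balanced-⌊/2⌋ bal))
  ; partner   = bipartitePartner a
  ; matched   = bipartitePartner-matched bal
  }

corollary3p11 : (t p : ℕ) (G : Graph p) → 1 ≤ t → Family t p G →
    (k : ℕ) → 1 ≤ k → k ≤ p ∸ 1 →
    IndependenceNumberTok G k (rVal p k ⊔ ((p C k) ∸ rVal p k))
corollary3p11 t _ _ _ isPath  k _ _ = independenceNumber-rVal (pathCertificate t) k
corollary3p11 t _ _ _ isKtt   k _ _ = independenceNumber-rVal (bipartiteCertificate (balanced-≡ t)) k
corollary3p11 t _ _ _ isKtt+1 k _ _ = independenceNumber-rVal (bipartiteCertificate (balanced-suc-≡ t)) k
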